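{- Let $n\ge 3$ be odd and let $\mathcal{G}=(K_{n-1}-M)+K_1$, where $M$ is a perfect matching of $K_{n-1}$. Then the direct product $\mathcal{G}\times C_4$ is distance magic if and only if $n=5$.
   Context: $G+K_1$ denotes the join of $G$ with a single new vertex adjacent to all vertices of $G$. The direct (tensor) product $G\times H$ has vertex set $V(G)\times V(H)$, with $(g,h)\sim(g',h')$ iff $gg'\in E(G)$ and $hh'\in E(H)$. A distance magic labeling of a graph on $N$ vertices is a bijection $f:V\to\{1,\dots,N\}$ such that $\sum_{v\in N(u)}f(v)$ is the same for all vertices $u$; a graph is distance magic if it has one. -}

module Defs where

open import Data.Nat using (ℕ; zero; suc; _+_; _*_; _∸_; _%_)
open import Data.Bool using (Bool; true; false; _∧_; _∨_; not; if_then_else_)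
open import Data.Fin using (Fin; zero; suc; toℕ; remQuot)
open import Data.Fin.Properties using (_≟_)
open import Data.Product using (Σ; _×_; _,_; proj₁; proj₂)
open import Data.List using (List; map)
open import Data.Nat.ListAction using (sum)
open import Data.List using () renaming (allFin to allFinL)
open import Function.Bundles using (_⤖_; Bijection)
open import Relation.Binary.PropositionalEquality using (_≡_; _≢_)
open import Relation.Nullary.Decidable using (⌊_⌋)
import Data.Nat.Properties as ℕP

Graph : ℕ → Set
Graph N = Fin N → Fin N → Bool

neighbourSum : ∀ {N} → Graph N → (Fin N → ℕ) → Fin N → ℕ
neighbourSum {N} G f u = sum (map (λ v → if G u v then f v else 0) (allFinL N))

-- Labeling induced by a bijection σ : Fin N ⤖ Fin N, i.e. v ↦ 1 + σ v ∈ {1,…,N}.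
-- Every bijection V → {1,…,N} is of this form.
labelOf : ∀ {N} → Fin N ⤖ Fin N → Fin N → ℕ
labelOf σ v = suc (toℕ (Bijection.to σ v))

IsDistanceMagicLabeling : ∀ {N} → Graph N → (Fin N ⤖ Fin N) → Set
IsDistanceMagicLabeling G σ =
  Σ ℕ λ k → ∀ u → neighbourSum G (labelOf σ) u ≡ k

DistanceMagic : ∀ {N} → Graph N → Set
DistanceMagic {N} G = Σ (Fin N ⤖ Fin N) λ σ → IsDistanceMagicLabeling G σ

-- Direct (tensor) product; vertex (g , h) is encoded as combine g h.
_×ᵍ_ : ∀ {m k} → Graph m → Graph k → Graph (m * k)
_×ᵍ_ {m} {k} G H x y with remQuot {m} k x | remQuot {m} k y
... | (g , h) | (g' , h') = G g g' ∧ H h h'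

C₄ : Graph 4
C₄ i j = ⌊ toℕ j ℕP.≟ ((toℕ i + 1) % 4) ⌋ ∨ ⌊ toℕ i ℕP.≟ ((toℕ j + 1) % 4) ⌋

-- A perfect matching of the complete graph on Fin m, given as a
-- fixed-point-free involution (each vertex i is matched with M i).
IsPerfectMatching : ∀ {m} → (Fin m → Fin m) → Set
IsPerfectMatching {m} M = (∀ i → M (M i) ≡ i) × (∀ i → M i ≢ i)

-- (K_m - M) + K₁ on Fin (suc m): vertex zero is the apex K₁,
-- vertex suc i is vertex i of K_m - M.
KminusMplusK1 : ∀ {m} → (Fin m → Fin m) → Graph (suc m)
KminusMplusK1 M zero    zero    = false
KminusMplusK1 M zero    (suc j) = true
KminusMplusK1 M (suc i) zero    = true
KminusMplusK1 M (suc i) (suc j) = not ⌊ i ≟ j ⌋ ∧ not ⌊ M i ≟ j ⌋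

-- Let ℓ be a distance magic labeling of G × C₄ with constant k, where G = (K_m − M) + K₁ and
-- m = n − 1, and let w₀, w₁ give at each vertex g of G the sum of its labels in the even and in
-- the odd columns of C₄.  Since the neighbourhood of (g , h) is N_G(g) × {h ± 1}, both w₀ and w₁
-- have constant neighbour sum k in G.  The apex sees every other vertex while a vertex i sees all
-- but i and M i, so w(i) + w(M i) = w(apex); summing over the matching gives 2k = m w(apex), hence
-- w₀(apex) = w₁(apex) =: a.  The labels add up to 2(a + k) = N(N + 1)/2 with N = 4(m + 1), that is
-- (m + 2) a = 2(m + 1)(4m + 5) ≡ 6 (mod m + 2).  So m + 2 divides 6 and n = 5.  For n = 5 each of
-- the three perfect matchings of K₄ admits an explicit labeling.
module Submission where

open import Defs
open import Data.Nat using (ℕ; zero; suc; _+_; _*_; _≤_; _∸_; _%_; s≤s; NonZero)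
open import Data.Nat.Properties
  using (+-identityʳ; +-assoc; +-comm; +-cancelˡ-≡; *-cancelˡ-≡; <⇒≱; m≤m+n; +-0-commutativeMonoid)
  renaming (_≟_ to _≟ℕ_)
open import Data.Nat.Divisibility using (_∣_; _∣?_; ∣m+n∣m⇒∣n; ∣⇒≤; m∣m*n)
open import Data.Nat.ListAction using () renaming (sum to sumˡ)
open import Data.Nat.Tactic.RingSolver using (solve-∀)
open import Data.Bool using (Bool; true; false; _∧_; not; if_then_else_)
open import Data.Fin using (Fin; zero; suc; toℕ; combine; _↑ˡ_; _↑ʳ_; #_)
open import Data.Fin.Patterns using (0F; 1F; 2F; 3F)
open import Data.Fin.Properties using (_≟_; all?; any?; remQuot-combine)
open import Data.Fin.Permutation using (permutation)
open import Data.List using (map; tabulate; allFin)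
open import Data.List.Properties using (map-cong)
open import Data.Vec using ([]; _∷_; lookup)
open import Data.Product using (_×_; _,_; proj₁; proj₂)
open import Data.Sum using (_⊎_; inj₁; inj₂)
open import Function.Base using (_∘_; id)
open import Function.Bundles using (_⇔_; _⤖_; mk⇔)
open import Function.Properties.Bijection using (⤖⇒↔)
open import Function.Properties.Inverse using (↔⇒⤖)
open import Relation.Binary.PropositionalEquality
  using (_≡_; _≢_; _≗_; refl; sym; trans; cong; cong₂; subst; module ≡-Reasoning)
open import Relation.Nullary using (yes; no; contradiction)
open import Relation.Nullary.Decidable using (⌊_⌋; does; True; toWitness; from-no)
open import Algebra.Properties.CommutativeMonoid.Sum +-0-commutativeMonoid
  using (sum; sum-syntax; sum-permute; ∑-distrib-+; sum-cong-≗; sum-replicate-zero)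

open ≡-Reasoning

sum-const : ∀ n c → ∑[ _ < n ] c ≡ n * c
sum-const zero    c = refl
sum-const (suc n) c = cong (c +_) (sum-const n c)

sum-if-∧ : ∀ {n} b (c : Fin n → Bool) (f : Fin n → ℕ) →
  ∑[ j < n ] (if b ∧ c j then f j else 0) ≡ (if b then ∑[ j < n ] (if c j then f j else 0) else 0)
sum-if-∧     true  c f = refl
sum-if-∧ {n} false c f = sum-replicate-zero n

-- Stated with does rather than ⌊_⌋: only does (suc a ≟ suc j) reduces to does (a ≟ j).
sum-at : ∀ {n} (a : Fin n) (f : Fin n → ℕ) → ∑[ j < n ] (if does (a ≟ j) then f j else 0) ≡ f a
sum-at {suc n} zero    f = trans (cong (f zero +_) (sum-replicate-zero n)) (+-identityʳ (f zero))
sum-at {suc n} (suc a) f = sum-at a (f ∘ suc)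

sum-without-two : ∀ {n} {a b : Fin n} → a ≢ b → (f : Fin n → ℕ) →
  ∑[ j < n ] (if not ⌊ a ≟ j ⌋ ∧ not ⌊ b ≟ j ⌋ then f j else 0) + (f a + f b) ≡ sum f
sum-without-two {n} {a} {b} a≢b f = begin
  sum rest + (f a + f b)
    ≡⟨ cong₂ (λ x y → sum rest + (x + y)) (sum-at a f) (sum-at b f) ⟨
  sum rest + (sum (at a) + sum (at b))
    ≡⟨ cong (sum rest +_) (∑-distrib-+ (at a) (at b)) ⟨
  sum rest + ∑[ j < n ] (at a j + at b j)
    ≡⟨ ∑-distrib-+ rest (λ j → at a j + at b j) ⟨
  ∑[ j < n ] (rest j + (at a j + at b j))
    ≡⟨ sum-cong-≗ partition ⟩
  sum f ∎
  where
  at : Fin n → Fin n → ℕ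
  at c j = if does (c ≟ j) then f j else 0
  rest : Fin n → ℕ
  rest j = if not ⌊ a ≟ j ⌋ ∧ not ⌊ b ≟ j ⌋ then f j else 0
  partition : ∀ j → rest j + (at a j + at b j) ≡ f j
  partition j with a ≟ j | b ≟ j
  ... | yes refl | yes refl = contradiction refl a≢b
  ... | yes _    | no _     = +-identityʳ (f j)
  ... | no _     | yes _    = refl
  ... | no _     | no _     = +-identityʳ (f j)

sum-↑ˡ-↑ʳ : ∀ m k (f : Fin (m + k) → ℕ) →
  sum f ≡ ∑[ i < m ] f (i ↑ˡ k) + ∑[ j < k ] f (m ↑ʳ j)
sum-↑ˡ-↑ʳ zero    k f = refl
sum-↑ˡ-↑ʳ (suc m) k f =
  trans (cong (f zero +_) (sum-↑ˡ-↑ʳ m k (f ∘ suc))) (sym (+-assoc (f zero) _ _))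

sum-combine : ∀ m k (f : Fin (m * k) → ℕ) →
  sum f ≡ ∑[ g < m ] ∑[ h < k ] f (combine g h)
sum-combine zero    k f = refl
sum-combine (suc m) k f =
  trans (sum-↑ˡ-↑ʳ k (m * k) f)
        (cong (∑[ h < k ] f (h ↑ˡ m * k) +_) (sum-combine m k (λ x → f (k ↑ʳ x))))

double-sum-suc-toℕ : ∀ N → 2 * ∑[ i < N ] suc (toℕ i) ≡ N * suc N
double-sum-suc-toℕ zero    = refl
double-sum-suc-toℕ (suc N) = begin
  2 * (1 + ∑[ i < N ] (1 + suc (toℕ i)))
    ≡⟨ cong (λ x → 2 * (1 + x)) (∑-distrib-+ {N} (λ _ → 1) (λ i → suc (toℕ i))) ⟩
  2 * (1 + (∑[ _ < N ] 1 + S))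
    ≡⟨ cong (λ x → 2 * (1 + (x + S))) (sum-const N 1) ⟩
  2 * (1 + (N * 1 + S))
    ≡⟨ expand N S ⟩
  2 + 2 * N + 2 * S
    ≡⟨ cong (2 + 2 * N +_) (double-sum-suc-toℕ N) ⟩
  2 + 2 * N + N * suc N
    ≡⟨ collect N ⟩
  suc N * suc (suc N) ∎
  where
  S : ℕ
  S = ∑[ i < N ] suc (toℕ i)
  expand : ∀ N S → 2 * (1 + (N * 1 + S)) ≡ 2 + 2 * N + 2 * S
  expand = solve-∀
  collect : ∀ N → 2 + 2 * N + N * suc N ≡ suc N * suc (suc N)
  collect = solve-∀

sumˡ-map-tabulate : ∀ {A : Set} {n} (f : A → ℕ) (g : Fin n → A) →
  sumˡ (map f (tabulate g)) ≡ sum (f ∘ g)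
sumˡ-map-tabulate {n = zero}  f g = refl
sumˡ-map-tabulate {n = suc n} f g = cong (f (g zero) +_) (sumˡ-map-tabulate f (g ∘ suc))

double-sum-labelOf : ∀ {N} (σ : Fin N ⤖ Fin N) → 2 * sum (labelOf σ) ≡ N * suc N
double-sum-labelOf {N} σ =
  trans (cong (2 *_) (sym (sum-permute (λ i → suc (toℕ i)) (⤖⇒↔ σ)))) (double-sum-suc-toℕ N)

neighbourSum≡sum : ∀ {N} (G : Graph N) (f : Fin N → ℕ) u →
  neighbourSum G f u ≡ ∑[ v < N ] (if G u v then f v else 0)
neighbourSum≡sum G f u = sumˡ-map-tabulate (λ v → if G u v then f v else 0) id

neighbourSum-congˡ : ∀ {N} {G G' : Graph N} u → (∀ v → G u v ≡ G' u v) →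
  ∀ f → neighbourSum G f u ≡ neighbourSum G' f u
neighbourSum-congˡ {N} u G≗G' f =
  cong sumˡ (map-cong (λ v → cong (λ b → if b then f v else 0) (G≗G' v)) (allFin N))

neighbourSum-congʳ : ∀ {N} (G : Graph N) {f f' : Fin N → ℕ} → f ≗ f' →
  ∀ u → neighbourSum G f u ≡ neighbourSum G f' u
neighbourSum-congʳ {N} G f≗f' u =
  cong sumˡ (map-cong (λ v → cong (if G u v then_else 0) (f≗f' v)) (allFin N))

distanceMagic-cong : ∀ {N} {G G' : Graph N} → (∀ u v → G u v ≡ G' u v) →
  DistanceMagic G → DistanceMagic G'
distanceMagic-cong {G = G} {G'} G≗G' (σ , k , magic) =
  σ , k , λ u → trans (sym (neighbourSum-congˡ {G = G} {G'} u (G≗G' u) (labelOf σ))) (magic u)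

×ᵍ-combine : ∀ {m k} (G : Graph m) (H : Graph k) g h g' h' →
  (G ×ᵍ H) (combine g h) (combine g' h') ≡ (G g g' ∧ H h h')
×ᵍ-combine {m} {k} G H g h g' h' =
  cong₂ (λ p q → G (proj₁ p) (proj₁ q) ∧ H (proj₂ p) (proj₂ q))
        (remQuot-combine {m} {k} g h) (remQuot-combine {m} {k} g' h')

×ᵍ-congˡ : ∀ {m k} {G G' : Graph m} (H : Graph k) → (∀ a b → G a b ≡ G' a b) →
  ∀ x y → (G ×ᵍ H) x y ≡ (G' ×ᵍ H) x y
×ᵍ-congˡ H G≗G' x y = cong (_∧ _) (G≗G' _ _)

neighbourSum-×ᵍ : ∀ {m k} (G : Graph m) (H : Graph k) (f : Fin (m * k) → ℕ) g h →
  neighbourSum (G ×ᵍ H) f (combine g h) ≡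
  neighbourSum G (λ g' → neighbourSum H (λ h' → f (combine g' h')) h) g
neighbourSum-×ᵍ {m} {k} G H f g h = begin
  neighbourSum (G ×ᵍ H) f (combine g h)
    ≡⟨ neighbourSum≡sum (G ×ᵍ H) f (combine g h) ⟩
  ∑[ v < m * k ] (if (G ×ᵍ H) (combine g h) v then f v else 0)
    ≡⟨ sum-combine m k _ ⟩
  ∑[ g' < m ] ∑[ h' < k ] (if (G ×ᵍ H) (combine g h) (combine g' h') then f (combine g' h') else 0)
    ≡⟨ sum-cong-≗ (λ g' → sum-cong-≗ (λ h' →
         cong (λ b → if b then f (combine g' h') else 0) (×ᵍ-combine G H g h g' h'))) ⟩
  ∑[ g' < m ] ∑[ h' < k ] (if G g g' ∧ H h h' then f (combine g' h') else 0)
    ≡⟨ sum-cong-≗ (λ g' → sum-if-∧ (G g g') (H h) (f ∘ combine g')) ⟩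
  ∑[ g' < m ] (if G g g' then ∑[ h' < k ] (if H h h' then f (combine g' h') else 0) else 0)
    ≡⟨ sum-cong-≗ (λ g' → cong (if G g g' then_else 0) (sym (neighbourSum≡sum H _ h))) ⟩
  ∑[ g' < m ] (if G g g' then neighbourSum H (f ∘ combine g') h else 0)
    ≡⟨ neighbourSum≡sum G _ g ⟨
  neighbourSum G (λ g' → neighbourSum H (f ∘ combine g') h) g ∎

evenColumns oddColumns : ∀ {m} → (Fin (m * 4) → ℕ) → Fin m → ℕ
evenColumns f g = f (combine g 0F) + f (combine g 2F)
oddColumns  f g = f (combine g 1F) + f (combine g 3F)

neighbourSum-×C₄-0 : ∀ {m} (G : Graph m) (f : Fin (m * 4) → ℕ) g →
  neighbourSum (G ×ᵍ C₄) f (combine g 0F) ≡ neighbourSum G (oddColumns f) g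
neighbourSum-×C₄-0 G f g = trans (neighbourSum-×ᵍ G C₄ f g 0F)
  (neighbourSum-congʳ G (λ g' → cong (f (combine g' 1F) +_) (+-identityʳ (f (combine g' 3F)))) g)

neighbourSum-×C₄-1 : ∀ {m} (G : Graph m) (f : Fin (m * 4) → ℕ) g →
  neighbourSum (G ×ᵍ C₄) f (combine g 1F) ≡ neighbourSum G (evenColumns f) g
neighbourSum-×C₄-1 G f g = trans (neighbourSum-×ᵍ G C₄ f g 1F)
  (neighbourSum-congʳ G (λ g' → cong (f (combine g' 0F) +_) (+-identityʳ (f (combine g' 2F)))) g)

sum-columns : ∀ {m} (f : Fin (m * 4) → ℕ) →
  sum f ≡ sum (evenColumns {m} f) + sum (oddColumns {m} f)
sum-columns {m} f = begin
  sum f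
    ≡⟨ sum-combine m 4 f ⟩
  ∑[ g < m ] ∑[ h < 4 ] f (combine g h)
    ≡⟨ sum-cong-≗ {m} (λ g →
         regroup (f (combine g 0F)) (f (combine g 1F)) (f (combine g 2F)) (f (combine g 3F))) ⟩
  ∑[ g < m ] (evenColumns f g + oddColumns f g)
    ≡⟨ ∑-distrib-+ {m} (evenColumns f) (oddColumns f) ⟩
  sum (evenColumns {m} f) + sum (oddColumns {m} f) ∎
  where
  regroup : ∀ a b c d → a + (b + (c + (d + 0))) ≡ (a + c) + (b + d)
  regroup = solve-∀

neighbourSum-apex : ∀ {m} (M : Fin m → Fin m) (w : Fin (suc m) → ℕ) →
  neighbourSum (KminusMplusK1 M) w zero ≡ sum (w ∘ suc)
neighbourSum-apex M w = neighbourSum≡sum (KminusMplusK1 M) w zero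

neighbourSum-nonApex : ∀ {m} (M : Fin m → Fin m) → (∀ i → M i ≢ i) →
  (w : Fin (suc m) → ℕ) (i : Fin m) →
  neighbourSum (KminusMplusK1 M) w (suc i) + (w (suc i) + w (suc (M i))) ≡ w zero + sum (w ∘ suc)
neighbourSum-nonApex M noFixedPoint w i = begin
  neighbourSum (KminusMplusK1 M) w (suc i) + (w (suc i) + w (suc (M i)))
    ≡⟨ cong (_+ (w (suc i) + w (suc (M i)))) (neighbourSum≡sum (KminusMplusK1 M) w (suc i)) ⟩
  w zero + rest + (w (suc i) + w (suc (M i)))
    ≡⟨ +-assoc (w zero) rest _ ⟩
  w zero + (rest + (w (suc i) + w (suc (M i))))
    ≡⟨ cong (w zero +_) (sum-without-two (noFixedPoint i ∘ sym) (w ∘ suc)) ⟩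
  w zero + sum (w ∘ suc) ∎
  where
  rest : ℕ
  rest = ∑[ j < _ ] (if not ⌊ i ≟ j ⌋ ∧ not ⌊ M i ≟ j ⌋ then w (suc j) else 0)

constantNeighbourSum-KminusMplusK1 : ∀ {m} {M : Fin m → Fin m} → IsPerfectMatching M →
  (w : Fin (suc m) → ℕ) {k : ℕ} → (∀ g → neighbourSum (KminusMplusK1 M) w g ≡ k) →
  sum (w ∘ suc) ≡ k × k + k ≡ m * w zero
constantNeighbourSum-KminusMplusK1 {m} {M} (involutive , noFixedPoint) w {k} magic =
  sum≡k , doubling
  where
  sum≡k : sum (w ∘ suc) ≡ k
  sum≡k = trans (sym (neighbourSum-apex M w)) (magic zero)
  partners : ∀ i → w (suc i) + w (suc (M i)) ≡ w zero
  partners i = +-cancelˡ-≡ k _ _ (begin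
    k + (w (suc i) + w (suc (M i)))
      ≡⟨ cong (_+ _) (magic (suc i)) ⟨
    neighbourSum (KminusMplusK1 M) w (suc i) + (w (suc i) + w (suc (M i)))
      ≡⟨ neighbourSum-nonApex M noFixedPoint w i ⟩
    w zero + sum (w ∘ suc)
      ≡⟨ cong (w zero +_) sum≡k ⟩
    w zero + k
      ≡⟨ +-comm (w zero) k ⟩
    k + w zero ∎)
  doubling : k + k ≡ m * w zero
  doubling = begin
    k + k
      ≡⟨ cong₂ _+_ sum≡k sum≡k ⟨
    sum (w ∘ suc) + sum (w ∘ suc)
      ≡⟨ cong (sum (w ∘ suc) +_) (sum-permute (w ∘ suc) (permutation M M involutive involutive)) ⟩
    sum (w ∘ suc) + sum (w ∘ suc ∘ M)
      ≡⟨ ∑-distrib-+ (w ∘ suc) (w ∘ suc ∘ M) ⟨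
    ∑[ i < m ] (w (suc i) + w (suc (M i)))
      ≡⟨ sum-cong-≗ partners ⟩
    ∑[ i < m ] w zero
      ≡⟨ sum-const m (w zero) ⟩
    m * w zero ∎

labelSum⇒2+m∣6 : ∀ m a k T → 2 * T ≡ (suc m * 4) * suc (suc m * 4) →
  T ≡ (a + k) + (a + k) → k + k ≡ m * a → 2 + m ∣ 6
labelSum⇒2+m∣6 m a k T 2T≡ T≡ k+k≡ =
  ∣m+n∣m⇒∣n (subst (2 + m ∣_) key (m∣m*n a)) (m∣m*n (8 * m + 2))
  where
  expand : ∀ m a → 2 * ((2 + m) * a) ≡ 4 * a + 2 * (m * a)
  expand = solve-∀
  regroup : ∀ a k → 4 * a + 2 * (k + k) ≡ 2 * ((a + k) + (a + k))
  regroup = solve-∀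
  factor : ∀ m → (suc m * 4) * suc (suc m * 4) ≡ 2 * ((2 + m) * (8 * m + 2) + 6)
  factor = solve-∀
  key : (2 + m) * a ≡ (2 + m) * (8 * m + 2) + 6
  key = *-cancelˡ-≡ _ _ 2 (begin
    2 * ((2 + m) * a)                    ≡⟨ expand m a ⟩
    4 * a + 2 * (m * a)                  ≡⟨ cong (λ x → 4 * a + 2 * x) k+k≡ ⟨
    4 * a + 2 * (k + k)                  ≡⟨ regroup a k ⟩
    2 * ((a + k) + (a + k))              ≡⟨ cong (2 *_) T≡ ⟨
    2 * T                                ≡⟨ 2T≡ ⟩
    (suc m * 4) * suc (suc m * 4)        ≡⟨ factor m ⟩
    2 * ((2 + m) * (8 * m + 2) + 6)      ∎)

distanceMagic⇒2+m∣6 : ∀ {m} .{{_ : NonZero m}} {M : Fin m → Fin m} → IsPerfectMatching M →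
  DistanceMagic (KminusMplusK1 M ×ᵍ C₄) → 2 + m ∣ 6
distanceMagic⇒2+m∣6 {m} {M} isPM (σ , k , magic) =
  labelSum⇒2+m∣6 m (evens zero) k (sum ℓ) (double-sum-labelOf σ) labelSum (proj₂ even)
  where
  ℓ : Fin (suc m * 4) → ℕ
  ℓ = labelOf σ
  evens odds : Fin (suc m) → ℕ
  evens = evenColumns ℓ
  odds  = oddColumns ℓ
  even : sum (evens ∘ suc) ≡ k × k + k ≡ m * evens zero
  even = constantNeighbourSum-KminusMplusK1 isPM evens λ g →
    trans (sym (neighbourSum-×C₄-1 (KminusMplusK1 M) ℓ g)) (magic (combine g 1F))
  odd : sum (odds ∘ suc) ≡ k × k + k ≡ m * odds zero
  odd = constantNeighbourSum-KminusMplusK1 isPM odds λ g →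
    trans (sym (neighbourSum-×C₄-0 (KminusMplusK1 M) ℓ g)) (magic (combine g 0F))
  apexColumns : odds zero ≡ evens zero
  apexColumns = *-cancelˡ-≡ _ _ m (trans (sym (proj₂ odd)) (proj₂ even))
  labelSum : sum ℓ ≡ (evens zero + k) + (evens zero + k)
  labelSum = trans (sum-columns {suc m} ℓ)
    (cong₂ _+_ (cong (evens zero +_) (proj₁ even)) (cong₂ _+_ apexColumns (proj₁ odd)))

4+p∣6⇒p≡2 : ∀ p → 4 + p ∣ 6 → p ≡ 2
4+p∣6⇒p≡2 0 4∣6 = contradiction 4∣6 (from-no (4 ∣? 6))
4+p∣6⇒p≡2 1 5∣6 = contradiction 5∣6 (from-no (5 ∣? 6))
4+p∣6⇒p≡2 2 _   = refl
4+p∣6⇒p≡2 (suc (suc (suc p))) d∣6 = contradiction (∣⇒≤ d∣6) (<⇒≱ (m≤m+n 7 p))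

preimage : ∀ {n} → (Fin n → Fin n) → Fin n → Fin n
preimage f y with any? (λ x → f x ≟ y)
... | yes (x , _) = x
... | no _        = y

bijectionOfTable : ∀ {n} (f : Fin n → Fin n) →
  {True (all? (λ y → f (preimage f y) ≟ y))} →
  {True (all? (λ x → preimage f (f x) ≟ x))} → Fin n ⤖ Fin n
bijectionOfTable f {rightInverse} {leftInverse} =
  ↔⇒⤖ (permutation f (preimage f) (toWitness rightInverse) (toWitness leftInverse))

distanceMagicOfLabeling : ∀ {N} (G : Graph N) (σ : Fin N ⤖ Fin N) (k : ℕ) →
  {True (all? (λ u → neighbourSum G (labelOf σ) u ≟ℕ k))} → DistanceMagic G
distanceMagicOfLabeling G σ k {magic} = σ , k , toWitness magic

KminusMplusK1-cong : ∀ {m} {M M' : Fin m → Fin m} → M ≗ M' →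
  ∀ a b → KminusMplusK1 M a b ≡ KminusMplusK1 M' a b
KminusMplusK1-cong M≗M' zero    zero    = refl
KminusMplusK1-cong M≗M' zero    (suc j) = refl
KminusMplusK1-cong M≗M' (suc i) zero    = refl
KminusMplusK1-cong M≗M' (suc i) (suc j) = cong (λ x → not ⌊ i ≟ j ⌋ ∧ not ⌊ x ≟ j ⌋) (M≗M' i)

matching₀₁ matching₀₂ matching₀₃ : Fin 4 → Fin 4
matching₀₁ 0F = 1F
matching₀₁ 1F = 0F
matching₀₁ 2F = 3F
matching₀₁ 3F = 2F
matching₀₂ 0F = 2F
matching₀₂ 1F = 3F
matching₀₂ 2F = 0F
matching₀₂ 3F = 1F
matching₀₃ 0F = 3F
matching₀₃ 1F = 2F
matching₀₃ 2F = 1F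
matching₀₃ 3F = 0F

involution-partner : ∀ {m} {M : Fin m → Fin m} → (∀ i → M (M i) ≡ i) → ∀ {i j} → M i ≡ j → M j ≡ i
involution-partner involutive {i} refl = involutive i

module _ (M : Fin 4 → Fin 4) (isPM : IsPerfectMatching M) where
  private
    partner : ∀ {i j} → M i ≡ j → M j ≡ i
    partner = involution-partner (proj₁ isPM)
    noFixedPoint : ∀ i → M i ≢ i
    noFixedPoint = proj₂ isPM

  perfectMatchings-Fin4 : M ≗ matching₀₁ ⊎ M ≗ matching₀₂ ⊎ M ≗ matching₀₃
  perfectMatchings-Fin4 with M 0F in M0
  ... | 0F = contradiction M0 (noFixedPoint 0F)
  ... | 1F with M 2F in M2
  ...   | 0F = contradiction (trans (sym M0) (partner M2)) λ ()
  ...   | 1F = contradiction (trans (sym (partner M0)) (partner M2)) λ ()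
  ...   | 2F = contradiction M2 (noFixedPoint 2F)
  ...   | 3F = inj₁ λ { 0F → M0 ; 1F → partner M0 ; 2F → M2 ; 3F → partner M2 }
  perfectMatchings-Fin4 | 2F with M 1F in M1
  ...   | 0F = contradiction (trans (sym M0) (partner M1)) λ ()
  ...   | 1F = contradiction M1 (noFixedPoint 1F)
  ...   | 2F = contradiction (trans (sym (partner M0)) (partner M1)) λ ()
  ...   | 3F = inj₂ (inj₁ λ { 0F → M0 ; 1F → M1 ; 2F → partner M0 ; 3F → partner M1 })
  perfectMatchings-Fin4 | 3F with M 1F in M1
  ...   | 0F = contradiction (trans (sym M0) (partner M1)) λ ()
  ...   | 1F = contradiction M1 (noFixedPoint 1F)
  ...   | 2F = inj₂ (inj₂ λ { 0F → M0 ; 1F → M1 ; 2F → partner M1 ; 3F → partner M0 })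
  ...   | 3F = contradiction (trans (sym (partner M0)) (partner M1)) λ ()

-- Vertex (g , h) of the product is entry 4 g + h of each table and is labelled by that entry plus one.
-- The even-column and the odd-column label sums of two matched rows both add up to 35, as for the apex.
magic₀₁ : DistanceMagic (KminusMplusK1 matching₀₁ ×ᵍ C₄)
magic₀₁ = distanceMagicOfLabeling (KminusMplusK1 matching₀₁ ×ᵍ C₄) (bijectionOfTable (lookup
  (# 14 ∷ # 15 ∷ # 19 ∷ # 18 ∷
   # 0  ∷ # 2  ∷ # 1  ∷ # 3  ∷
   # 13 ∷ # 10 ∷ # 17 ∷ # 16 ∷
   # 4  ∷ # 5  ∷ # 6  ∷ # 7  ∷
   # 9  ∷ # 8  ∷ # 12 ∷ # 11 ∷ []))) 70

magic₀₂ : DistanceMagic (KminusMplusK1 matching₀₂ ×ᵍ C₄)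
magic₀₂ = distanceMagicOfLabeling (KminusMplusK1 matching₀₂ ×ᵍ C₄) (bijectionOfTable (lookup
  (# 14 ∷ # 15 ∷ # 19 ∷ # 18 ∷
   # 0  ∷ # 2  ∷ # 1  ∷ # 3  ∷
   # 4  ∷ # 5  ∷ # 6  ∷ # 7  ∷
   # 13 ∷ # 10 ∷ # 17 ∷ # 16 ∷
   # 9  ∷ # 8  ∷ # 12 ∷ # 11 ∷ []))) 70

magic₀₃ : DistanceMagic (KminusMplusK1 matching₀₃ ×ᵍ C₄)
magic₀₃ = distanceMagicOfLabeling (KminusMplusK1 matching₀₃ ×ᵍ C₄) (bijectionOfTable (lookup
  (# 14 ∷ # 15 ∷ # 19 ∷ # 18 ∷
   # 0  ∷ # 2  ∷ # 1  ∷ # 3  ∷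
   # 4  ∷ # 5  ∷ # 6  ∷ # 7  ∷
   # 9  ∷ # 8  ∷ # 12 ∷ # 11 ∷
   # 13 ∷ # 10 ∷ # 17 ∷ # 16 ∷ []))) 70

distanceMagic-matching-cong : ∀ {m} {M M' : Fin m → Fin m} → M ≗ M' →
  DistanceMagic (KminusMplusK1 M' ×ᵍ C₄) → DistanceMagic (KminusMplusK1 M ×ᵍ C₄)
distanceMagic-matching-cong {M = M} {M'} M≗M' =
  distanceMagic-cong {G = KminusMplusK1 M' ×ᵍ C₄} (×ᵍ-congˡ C₄ (KminusMplusK1-cong (sym ∘ M≗M')))

perfectMatching-Fin4-distanceMagic : (M : Fin 4 → Fin 4) → IsPerfectMatching M →
  DistanceMagic (KminusMplusK1 M ×ᵍ C₄)
perfectMatching-Fin4-distanceMagic M isPM with perfectMatchings-Fin4 M isPM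
... | inj₁ M≗        = distanceMagic-matching-cong M≗ magic₀₁
... | inj₂ (inj₁ M≗) = distanceMagic-matching-cong M≗ magic₀₂
... | inj₂ (inj₂ M≗) = distanceMagic-matching-cong M≗ magic₀₃

theorem3p3 : (n : ℕ) → 3 ≤ n → n % 2 ≡ 1 →
    (M : Fin (n ∸ 1) → Fin (n ∸ 1)) → IsPerfectMatching M →
    DistanceMagic (KminusMplusK1 M ×ᵍ C₄) ⇔ (n ≡ 5)
theorem3p3 (suc (suc (suc p))) (s≤s (s≤s (s≤s _))) _ M isPM = mk⇔
  (λ magic → cong (3 +_) (4+p∣6⇒p≡2 p (distanceMagic⇒2+m∣6 isPM magic)))
  (λ { refl → perfectMatching-Fin4-distanceMagic M isPM })
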